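{- Let the schema consist of a unary relation symbol $P$ and a binary relation symbol $R$, and let $\mathbf{T}'$ be the unary CQ $\mathbf{T}'(x)\text{ :- }P(x)\wedge R(y_1,y_2)\wedge R(y_2,y_3)\wedge R(y_3,y_4)\wedge R(y_4,y_5)$. There is no pair $(E^+,E^-)$ of finite sets of acyclic structures with one distinguished element that uniquely characterizes $\mathbf{T}'$ with respect to the class of unary acyclic CQs.
   Context: A unary CQ is $q(x)\text{ :- }\alpha_1\wedge\dots\wedge\alpha_n$ with atoms $\alpha_i$ (other variables existentially quantified), where $x$ occurs in some atom; its canonical structure has its variables as elements, its atoms as facts, and $x$ as the distinguished element. A structure with one distinguished element $(A,a)$ is a positive example for $q$ if $a\in q(A)$ (equivalently, the canonical structure of $q$ maps homomorphically to $(A,a)$ with $x\mapsto a$), negative otherwise. Unary CQs are logically equivalent if they have the same answers on every structure. $(E^+,E^-)$ uniquely characterizes $q$ w.r.t. a class $\mathcal{C}$ if all of $E^+$ are positive and all of $E^-$ negative for $q$, and every $q'\in\mathcal{C}$ with this property is logically equivalent to $q$. The incidence graph of a structure is the bipartite multigraph on its elements and facts with one edge per occurrence of an element in a fact; a structure is acyclic if its incidence graph has no cycle (including length-2 cycles from parallel edges); a CQ is acyclic if its canonical structure is. -}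

module Defs where

open import Data.Nat using (ℕ; zero; suc; _≥_)
open import Data.Fin using (Fin; zero; suc; inject₁)
open import Data.Bool using (Bool; true; false; T)
open import Data.Unit using (tt)
open import Data.Sum using (_⊎_; inj₁; inj₂)
open import Data.Product using (Σ; ∃; ∃-syntax; _×_; _,_)
open import Data.List using (List)
open import Data.List.Relation.Unary.All using (All)
open import Relation.Nullary using (¬_)
open import Relation.Binary.PropositionalEquality using (_≡_)

-- Finite structures over the schema {P (unary), R (binary)} with one
-- distinguished element.  Elements are Fin n; relations are given as
-- Bool-valued (hence decidable) sets of tuples.

record PStructure : Set where
  field
    size : ℕ
    P    : Fin size → Bool
    R    : Fin size → Fin size → Bool
    dist : Fin size
open PStructure public

record Hom (A B : PStructure) : Set where
  field
    map    : Fin (size A) → Fin (size B)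
    presP  : ∀ a → T (P A a) → T (P B (map a))
    presR  : ∀ a b → T (R A a b) → T (R B (map a) (map b))
    presD  : map (dist A) ≡ dist B

-- Incidence graph: vertices are elements and facts; one edge per
-- occurrence of an element in a fact.

module _ (A : PStructure) where

  data Fact : Set where
    pfact : (a : Fin (size A)) → T (P A a) → Fact
    rfact : (a b : Fin (size A)) → T (R A a b) → Fact

  data Edge : Set where
    eP  : (a : Fin (size A)) → T (P A a) → Edge
    eR₁ : (a b : Fin (size A)) → T (R A a b) → Edge
    eR₂ : (a b : Fin (size A)) → T (R A a b) → Edge

  Node : Set
  Node = Fin (size A) ⊎ Fact

  edgeElem : Edge → Fin (size A)
  edgeElem (eP a _)    = a
  edgeElem (eR₁ a _ _) = a
  edgeElem (eR₂ _ b _) = b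

  edgeFact : Edge → Fact
  edgeFact (eP a p)    = pfact a p
  edgeFact (eR₁ a b r) = rfact a b r
  edgeFact (eR₂ a b r) = rfact a b r

  Joins : Edge → Node → Node → Set
  Joins e u w = (u ≡ inj₁ (edgeElem e) × w ≡ inj₂ (edgeFact e))
              ⊎ (u ≡ inj₂ (edgeFact e) × w ≡ inj₁ (edgeElem e))

  -- A cycle of length k ≥ 2: nodes v₀ … v_k with v_k = v₀, nodes v₀ … v_{k-1}
  -- pairwise distinct, edges e₁ … e_k pairwise distinct, e_i joining
  -- v_{i-1} and v_i.  (Length-2 cycles arise from parallel edges.)
  record Cycle : Set where
    field
      len      : ℕ
      len≥2    : len ≥ 2
      node     : Fin (suc len) → Node
      edge     : Fin len → Edge
      joins    : ∀ i → Joins (edge i) (node (inject₁ i)) (node (suc i))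
      closed   : node (Data.Fin.fromℕ len) ≡ node zero
      nodesInj : ∀ i j → node (inject₁ i) ≡ node (inject₁ j) → i ≡ j
      edgesInj : ∀ i j → edge i ≡ edge j → i ≡ j

  Acyclic : Set
  Acyclic = ¬ Cycle

-- Unary CQs, represented by their canonical structure: variables are the
-- elements, atoms are the facts, x is the distinguished element.  Every
-- variable (in particular x) occurs in some atom.

Occurs : (A : PStructure) → Fin (size A) → Set
Occurs A v = T (P A v) ⊎ ∃[ w ] (T (R A v w) ⊎ T (R A w v))

record UCQ : Set where
  field
    canon   : PStructure
    occurs  : ∀ v → Occurs canon v
open UCQ public

-- (A , a) is a positive example for q iff q's canonical structure maps
-- homomorphically to (A , a) sending x to a.
Positive : UCQ → PStructure → Set
Positive q A = Hom (canon q) A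

Negative : UCQ → PStructure → Set
Negative q A = ¬ Positive q A

pointAt : (A : PStructure) → Fin (size A) → PStructure
pointAt A a = record { size = size A ; P = P A ; R = R A ; dist = a }

Equivalent : UCQ → UCQ → Set
Equivalent q q' = ∀ (A : PStructure) (a : Fin (size A)) →
  (Positive q (pointAt A a) → Positive q' (pointAt A a)) ×
  (Positive q' (pointAt A a) → Positive q (pointAt A a))

AcyclicCQ : UCQ → Set
AcyclicCQ q = Acyclic (canon q)

UniquelyCharacterizesAcyc : List PStructure → List PStructure → UCQ → Set
UniquelyCharacterizesAcyc E⁺ E⁻ q =
  All (Positive q) E⁺ × All (Negative q) E⁻ ×
  (∀ (q' : UCQ) → AcyclicCQ q' →
     All (Positive q') E⁺ → All (Negative q') E⁻ → Equivalent q q')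

-- T'(x) :- P(x) ∧ R(y₁,y₂) ∧ R(y₂,y₃) ∧ R(y₃,y₄) ∧ R(y₄,y₅)
-- variables: 0 = x, 1 = y₁, …, 5 = y₅

T'P : Fin 6 → Bool
T'P zero = true
T'P _    = false

T'R : Fin 6 → Fin 6 → Bool
T'R (suc zero) (suc (suc zero)) = true
T'R (suc (suc zero)) (suc (suc (suc zero))) = true
T'R (suc (suc (suc zero))) (suc (suc (suc (suc zero)))) = true
T'R (suc (suc (suc (suc zero)))) (suc (suc (suc (suc (suc zero))))) = true
T'R _ _ = false

T'canon : PStructure
T'canon = record { size = 6 ; P = T'P ; R = T'R ; dist = zero }

T'occurs : ∀ v → Occurs T'canon v
T'occurs zero = inj₁ tt
T'occurs (suc zero) = inj₂ (suc (suc zero) , inj₁ tt)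
T'occurs (suc (suc zero)) = inj₂ (suc (suc (suc zero)) , inj₁ tt)
T'occurs (suc (suc (suc zero))) = inj₂ (suc (suc (suc (suc zero))) , inj₁ tt)
T'occurs (suc (suc (suc (suc zero)))) = inj₂ (suc (suc (suc (suc (suc zero)))) , inj₁ tt)
T'occurs (suc (suc (suc (suc (suc zero))))) = inj₂ (suc (suc (suc (suc zero))) , inj₂ tt)

T' : UCQ
T' = record { canon = T'canon ; occurs = T'occurs }

module Submission where

-- Following the paper, for every L we build an acyclic CQ q_L, whose
-- canonical structure Q (2L+7) consists of P(x) and a long "zigzag" of
-- R-edges of period 8 (a tree, every edge climbing one level 0 … 4), with:
--   * Q ⇒ T' (levels), so q_L is positive wherever T' is;
--   * no T' answer on Q (heights 0 … 3 increase along edges), so q_L ≢ T';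
--   * Q acyclic, by a ranking criterion: irreflexive R and at most one fact
--     joining each element to smaller ones;
--   * if Q maps to an acyclic e where T' fails, the spine of the zigzag maps
--     to a walk that never stays and never returns after two steps (else e
--     has a directed 4-walk, i.e. a T' answer), and such walks in acyclic
--     structures are injective, so e has more than L elements.
-- With L the total size of E⁻, q_L then contradicts unique characterization.

open import Defs
open import Data.Bool using (Bool; true; false; T; if_then_else_)
open import Data.Bool.Properties using (T-irrelevant)
open import Data.Empty using (⊥; ⊥-elim)
open import Data.Fin using (Fin; zero; suc; toℕ; fromℕ; fromℕ<; inject₁)
open import Data.Fin.Properties
  using (toℕ-injective; toℕ-inject₁; toℕ-fromℕ; toℕ-fromℕ<; fromℕ<-toℕ; toℕ<n; pigeonhole)
  renaming (suc-injective to Fin-suc-injective)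
open import Data.Fin.Relation.Unary.Top using (view; ‵fromℕ; ‵inject₁)
open import Data.List using (List; []; _∷_)
open import Data.List.Relation.Unary.All using (All; []; _∷_)
  renaming (map to All-map; zip to All-zip; zipWith to All-zipWith)
open import Data.Nat using (ℕ; zero; suc; _+_; _∸_; pred; _≤_; _<_; z≤n; s≤s; s≤s⁻¹; _<?_; _≤?_; _≟_)
open import Data.Nat.Properties
open import Data.Product using (Σ; _×_; _,_; proj₁; proj₂) renaming (map₁ to ×-map₁)
open import Data.Product.Properties using (,-injective)
open import Data.Sum using (_⊎_; inj₁; inj₂; swap) renaming (map to ⊎-map)
open import Data.Sum.Properties using (inj₁-injective; inj₂-injective)
open import Data.Unit using (tt)
open import Function using (_∘_; case_of_)
open import Relation.Binary.Definitions using (tri<; tri≈; tri>)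
open import Relation.Binary.PropositionalEquality
open import Relation.Nullary using (¬_; yes; no)
open import Relation.Nullary.Decidable using (Dec; map′; _×-dec_; _⊎-dec_; isYes; toWitness; fromWitness; T?)

maxFin : ∀ {n} → 1 ≤ n → (f : Fin n → ℕ) → Σ (Fin n) λ k → ∀ k' → f k' ≤ f k
maxFin {suc zero} _ f = zero , λ { zero → ≤-refl }
maxFin {suc (suc m)} _ f with maxFin (s≤s z≤n) (λ i → f (suc i))
... | k , k-max with f zero ≤? f (suc k)
...   | yes p = suc k , λ { zero → p ; (suc i) → k-max i }
...   | no ¬p = zero , λ { zero → ≤-refl ; (suc i) → ≤-trans (k-max i) (<⇒≤ (≰⇒> ¬p)) }

inject₁≢suc : ∀ {m} (i : Fin m) → inject₁ i ≢ suc i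
inject₁≢suc zero ()
inject₁≢suc (suc i) eq = inject₁≢suc i (Fin-suc-injective eq)

module _ {X : Set} where

  predecessor : ∀ {n} (node : Fin (suc n) → X) → node (fromℕ n) ≡ node zero → 2 ≤ n →
                ∀ i → Σ (Fin n) λ j → j ≢ i × node (suc j) ≡ node (inject₁ i)
  predecessor {suc zero} _ _ (s≤s ()) _
  predecessor {suc (suc l)} node closed _ zero    = fromℕ (suc l) , (λ ()) , closed
  predecessor {suc (suc l)} node closed _ (suc i) = inject₁ i , inject₁≢suc i , refl

  successor : ∀ {n} (node : Fin (suc n) → X) → node (fromℕ n) ≡ node zero → 2 ≤ n →
              ∀ i → Σ (Fin n) λ j → j ≢ i × node (inject₁ j) ≡ node (suc i)
  successor {suc zero} _ _ (s≤s ()) _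
  successor {suc (suc l)} node closed _ i with view i
  ... | ‵fromℕ     = zero , (λ ()) , sym closed
  ... | ‵inject₁ j = suc j , (λ eq → inject₁≢suc j (sym eq)) , refl

-- Even and odd positions: position 2t of the incidence cycle of a walk holds
-- its t-th element, position 2t+1 the fact of its t-th step.
double : ℕ → ℕ
double zero    = zero
double (suc t) = suc (suc (double t))

half : ℕ → ℕ
half zero          = zero
half (suc zero)    = zero
half (suc (suc m)) = suc (half m)

isOdd : ℕ → Bool
isOdd zero          = false
isOdd (suc zero)    = true
isOdd (suc (suc m)) = isOdd m

half-double : ∀ t → half (double t) ≡ t
half-double zero    = refl
half-double (suc t) = cong suc (half-double t)

half-suc-double : ∀ t → half (suc (double t)) ≡ t
half-suc-double zero    = refl
half-suc-double (suc t) = cong suc (half-suc-double t)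

isOdd-double : ∀ t → isOdd (double t) ≡ false
isOdd-double zero    = refl
isOdd-double (suc t) = isOdd-double t

isOdd-suc-double : ∀ t → isOdd (suc (double t)) ≡ true
isOdd-suc-double zero    = refl
isOdd-suc-double (suc t) = isOdd-suc-double t

parity : ∀ m → (Σ ℕ λ t → m ≡ double t) ⊎ (Σ ℕ λ t → m ≡ suc (double t))
parity zero = inj₁ (0 , refl)
parity (suc m) with parity m
... | inj₁ (t , refl) = inj₂ (t , refl)
... | inj₂ (t , refl) = inj₁ (suc t , refl)

double-<-inv : ∀ {t g} → double t < double g → t < g
double-<-inv {zero}  {suc g} _             = s≤s z≤n
double-<-inv {suc t} {suc g} (s≤s (s≤s p)) = s≤s (double-<-inv p)

suc-double-<-inv : ∀ {t g} → suc (double t) < double g → t < g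
suc-double-<-inv p = double-<-inv (<-trans (n<1+n _) p)

half-< : ∀ {g} m → m < double g → half m < g
half-< m m< with parity m
... | inj₁ (t , refl) rewrite half-double t     = double-<-inv m<
... | inj₂ (t , refl) rewrite half-suc-double t = suc-double-<-inv m<

double-mono : ∀ {a b} → a ≤ b → double a ≤ double b
double-mono z≤n     = z≤n
double-mono (s≤s p) = s≤s (s≤s (double-mono p))

<⇒+suc : ∀ {a b} → a < b → Σ ℕ λ d → b ≡ a + suc d
<⇒+suc {zero}  {suc b} _       = b , refl
<⇒+suc {suc a} {suc b} (s≤s p) with <⇒+suc p
... | d , eq = d , cong suc eq

module _ (A : PStructure) where

  Incident : Edge A → Node A → Set
  Incident e (inj₁ a) = edgeElem A e ≡ a
  Incident e (inj₂ f) = edgeFact A e ≡ f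

  module CycleEdges (C : Cycle A) where
    open Cycle C

    step-incident : ∀ i → Incident (edge i) (node (inject₁ i)) × Incident (edge i) (node (suc i))
    step-incident i with joins i
    ... | inj₁ (p , q) rewrite p | q = refl , refl
    ... | inj₂ (p , q) rewrite p | q = refl , refl

    otherStep : ∀ i v → node (inject₁ i) ≡ v ⊎ node (suc i) ≡ v →
                Σ (Fin len) λ j → j ≢ i × Incident (edge j) v
    otherStep i v (inj₁ eq) with predecessor node closed len≥2 i
    ... | j , j≢i , nj = j , j≢i , subst (Incident (edge j)) (trans nj eq) (proj₂ (step-incident j))
    otherStep i v (inj₂ eq) with successor node closed len≥2 i
    ... | j , j≢i , nj = j , j≢i , subst (Incident (edge j)) (trans nj eq) (proj₁ (step-incident j))

    sameElement : ∀ i → Σ (Fin len) λ j → j ≢ i × edgeElem A (edge j) ≡ edgeElem A (edge i)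
    sameElement i = otherStep i _ (elementEnd (joins i))
      where
        elementEnd : ∀ {u w} → Joins A (edge i) u w →
                     u ≡ inj₁ (edgeElem A (edge i)) ⊎ w ≡ inj₁ (edgeElem A (edge i))
        elementEnd (inj₁ (p , _)) = inj₁ p
        elementEnd (inj₂ (_ , q)) = inj₂ q

    sameFact : ∀ i → Σ (Fin len) λ j → j ≢ i × edgeFact A (edge j) ≡ edgeFact A (edge i)
    sameFact i = otherStep i _ (factEnd (joins i))
      where
        factEnd : ∀ {u w} → Joins A (edge i) u w →
                  u ≡ inj₂ (edgeFact A (edge i)) ⊎ w ≡ inj₂ (edgeFact A (edge i))
        factEnd (inj₁ (_ , q)) = inj₂ q
        factEnd (inj₂ (p , _)) = inj₁ p

  binaryFact : (e e' : Edge A) → e ≢ e' → edgeFact A e ≡ edgeFact A e' →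
    Σ (Fin (size A)) λ a → Σ (Fin (size A)) λ b → Σ (T (R A a b)) λ r →
      edgeFact A e ≡ rfact a b r ×
      ((edgeElem A e ≡ a × edgeElem A e' ≡ b) ⊎ (edgeElem A e ≡ b × edgeElem A e' ≡ a))
  binaryFact (eP a p)    (eP .a .p)     e≢e' refl = ⊥-elim (e≢e' refl)
  binaryFact (eR₁ a b r) (eR₁ .a .b .r) e≢e' refl = ⊥-elim (e≢e' refl)
  binaryFact (eR₁ a b r) (eR₂ .a .b .r) _    refl = a , b , r , refl , inj₁ (refl , refl)
  binaryFact (eR₂ a b r) (eR₁ .a .b .r) _    refl = a , b , r , refl , inj₂ (refl , refl)
  binaryFact (eR₂ a b r) (eR₂ .a .b .r) e≢e' refl = ⊥-elim (e≢e' refl)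

  Irreflexive : Set
  Irreflexive = ∀ a → ¬ T (R A a a)

  occurrence-unique : Irreflexive → ∀ e e' →
    edgeFact A e ≡ edgeFact A e' → edgeElem A e ≡ edgeElem A e' → e ≡ e'
  occurrence-unique irr (eP a p)    (eP .a .p)     refl _    = refl
  occurrence-unique irr (eR₁ a b r) (eR₁ .a .b .r) refl _    = refl
  occurrence-unique irr (eR₁ a b r) (eR₂ .a .b .r) refl refl = ⊥-elim (irr a r)
  occurrence-unique irr (eR₂ a b r) (eR₁ .a .b .r) refl refl = ⊥-elim (irr a r)
  occurrence-unique irr (eR₂ a b r) (eR₂ .a .b .r) refl _    = refl

  FactBelow : Fin (size A) → Fin (size A) → Fin (size A) → Set
  FactBelow v a b = (a ≡ v × toℕ b < toℕ v) ⊎ (b ≡ v × toℕ a < toℕ v)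

  UniqueFactsBelow : Set
  UniqueFactsBelow = ∀ v a b a' b' → T (R A a b) → T (R A a' b') →
                     FactBelow v a b → FactBelow v a' b' → a ≡ a' × b ≡ b'

  factBelow : Irreflexive → ∀ {v c a b} → T (R A a b) → toℕ c ≤ toℕ v →
              (v ≡ a × c ≡ b) ⊎ (v ≡ b × c ≡ a) → FactBelow v a b
  factBelow irr r c≤v (inj₁ (refl , refl)) =
    inj₁ (refl , ≤∧≢⇒< c≤v λ eq → irr _ (subst (λ z → T (R A _ z)) (toℕ-injective eq) r))
  factBelow irr r c≤v (inj₂ (refl , refl)) =
    inj₂ (refl , ≤∧≢⇒< c≤v λ eq → irr _ (subst (λ z → T (R A z _)) (toℕ-injective eq) r))

  -- If no element of a cycle exceeds a, the fact of every cycle edge at a lies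
  -- below a: that fact is shared by a second cycle edge, whose element is at
  -- most a.
  cycleFactBelow : Irreflexive → (C : Cycle A) → ∀ a →
    (∀ k → toℕ (edgeElem A (Cycle.edge C k)) ≤ toℕ a) →
    ∀ k → edgeElem A (Cycle.edge C k) ≡ a →
    Σ (Fin (size A)) λ x → Σ (Fin (size A)) λ y → Σ (T (R A x y)) λ r →
      edgeFact A (Cycle.edge C k) ≡ rfact x y r × FactBelow a x y
  cycleFactBelow irr C a a-max k k∋a with CycleEdges.sameFact C k
  ... | s , s≢k , fs
    with binaryFact (Cycle.edge C k) (Cycle.edge C s) (λ eq → s≢k (sym (Cycle.edgesInj C k s eq))) (sym fs)
  ...   | x , y , r , fk , ends =
    x , y , r , fk , factBelow irr r (a-max s) (⊎-map (×-map₁ (trans (sym k∋a))) (×-map₁ (trans (sym k∋a))) ends)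

  factsAtMaximum : Irreflexive → UniqueFactsBelow → (C : Cycle A) → ∀ a →
    (∀ k → toℕ (edgeElem A (Cycle.edge C k)) ≤ toℕ a) →
    ∀ k k' → edgeElem A (Cycle.edge C k) ≡ a → edgeElem A (Cycle.edge C k') ≡ a →
    edgeFact A (Cycle.edge C k) ≡ edgeFact A (Cycle.edge C k')
  factsAtMaximum irr uniq C a a-max k k' k∋a k'∋a
    with cycleFactBelow irr C a a-max k k∋a | cycleFactBelow irr C a a-max k' k'∋a
  ... | x , y , r , fk , bk | x' , y' , r' , fk' , bk' with uniq a x y x' y' r r' bk bk'
  ...   | refl , refl = trans fk (trans (cong (rfact x y) (T-irrelevant r r')) (sym fk'))

  -- Ranking criterion for acyclicity: on a cycle take an edge i whose element a
  -- is largest; a second cycle edge j also has element a, and by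
  -- factsAtMaximum it has the same fact as i, so i and j are the same edge.
  acyclicByRank : Irreflexive → UniqueFactsBelow → Acyclic A
  acyclicByRank irr uniq C
    with maxFin (≤-trans (s≤s z≤n) (Cycle.len≥2 C)) (λ k → toℕ (edgeElem A (Cycle.edge C k)))
  ... | i , i-max with CycleEdges.sameElement C i
  ...   | j , j≢i , ej =
    j≢i (Cycle.edgesInj C j i (occurrence-unique irr _ _
          (factsAtMaximum irr uniq C _ i-max j i ej refl) ej))

  Adj : Fin (size A) → Fin (size A) → Set
  Adj x y = T (R A x y) ⊎ T (R A y x)

  adjFact : ∀ {x y} → Adj x y → Fact A
  adjFact {x} {y} (inj₁ r) = rfact x y r
  adjFact {x} {y} (inj₂ r) = rfact y x r

  occFrom occTo : ∀ {x y} → Adj x y → Edge A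
  occFrom {x} {y} (inj₁ r) = eR₁ x y r
  occFrom {x} {y} (inj₂ r) = eR₂ y x r
  occTo {x} {y} (inj₁ r) = eR₂ x y r
  occTo {x} {y} (inj₂ r) = eR₁ y x r

  occFrom-spec : ∀ {x y} (d : Adj x y) → edgeFact A (occFrom d) ≡ adjFact d × edgeElem A (occFrom d) ≡ x
  occFrom-spec (inj₁ _) = refl , refl
  occFrom-spec (inj₂ _) = refl , refl

  occTo-spec : ∀ {x y} (d : Adj x y) → edgeFact A (occTo d) ≡ adjFact d × edgeElem A (occTo d) ≡ y
  occTo-spec (inj₁ _) = refl , refl
  occTo-spec (inj₂ _) = refl , refl

  adjFact-ends : ∀ {x y} (d : Adj x y) →
    Σ (Fin (size A)) λ a → Σ (Fin (size A)) λ b → Σ (T (R A a b)) λ r →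
      adjFact d ≡ rfact a b r × ((a ≡ x × b ≡ y) ⊎ (a ≡ y × b ≡ x))
  adjFact-ends {x} {y} (inj₁ r) = x , y , r , refl , inj₁ (refl , refl)
  adjFact-ends {x} {y} (inj₂ r) = y , x , r , refl , inj₂ (refl , refl)

  -- A closed walk u 0, …, u g = u 0 of g ≥ 3 steps through pairwise distinct
  -- elements u 0, …, u (g-1) is a cycle of length 2g in the incidence graph:
  -- elements at even positions, the facts witnessing the steps at odd ones.
  module ClosedWalk (u : ℕ → Fin (size A)) (g : ℕ) (g≥3 : 3 ≤ g)
         (adj : ∀ t → t < g → Adj (u t) (u (suc t)))
         (closed : u g ≡ u 0)
         (distinct : ∀ s t → s < g → t < g → u s ≡ u t → s ≡ t) where

    -- g ≥ 3 rules out degenerate walks of one or two steps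
    0<g : 0 < g
    0<g = ≤-trans (s≤s z≤n) g≥3

    g≢ : ∀ {k} → k < 3 → g ≢ k
    g≢ k<3 refl = <⇒≱ k<3 g≥3

    -- the t-th step; beyond the walk an arbitrary one, to keep this total
    record Step : Set where
      constructor step
      field
        from to   : Fin (size A)
        adjacency : Adj from to

    stepAt : ℕ → Step
    stepAt t with t <? g
    ... | yes t<g = step _ _ (adj t t<g)
    ... | no _    = step _ _ (adj 0 0<g)

    stepAt-ends : ∀ t → t < g → Step.from (stepAt t) ≡ u t × Step.to (stepAt t) ≡ u (suc t)
    stepAt-ends t t<g with t <? g
    ... | yes _   = refl , refl
    ... | no t≮g = ⊥-elim (t≮g t<g)

    fact : ℕ → Fact A
    fact t = adjFact (Step.adjacency (stepAt t))

    occ₁ occ₂ : ℕ → Edge A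
    occ₁ t = occFrom (Step.adjacency (stepAt t))
    occ₂ t = occTo (Step.adjacency (stepAt t))

    occ₁-spec : ∀ t → t < g → edgeFact A (occ₁ t) ≡ fact t × edgeElem A (occ₁ t) ≡ u t
    occ₁-spec t t<g = proj₁ (occFrom-spec d) , trans (proj₂ (occFrom-spec d)) (proj₁ (stepAt-ends t t<g))
      where d : Adj (Step.from (stepAt t)) (Step.to (stepAt t))
            d = Step.adjacency (stepAt t)

    occ₂-spec : ∀ t → t < g → edgeFact A (occ₂ t) ≡ fact t × edgeElem A (occ₂ t) ≡ u (suc t)
    occ₂-spec t t<g = proj₁ (occTo-spec d) , trans (proj₂ (occTo-spec d)) (proj₂ (stepAt-ends t t<g))
      where d : Adj (Step.from (stepAt t)) (Step.to (stepAt t))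
            d = Step.adjacency (stepAt t)

    fact-ends : ∀ t → t < g →
      Σ (Fin (size A)) λ a → Σ (Fin (size A)) λ b → Σ (T (R A a b)) λ r →
        fact t ≡ rfact a b r × ((a ≡ u t × b ≡ u (suc t)) ⊎ (a ≡ u (suc t) × b ≡ u t))
    fact-ends t t<g with adjFact-ends (Step.adjacency (stepAt t)) | stepAt-ends t t<g
    ... | a , b , r , e , inj₁ (refl , refl) | p , q = a , b , r , e , inj₁ (p , q)
    ... | a , b , r , e , inj₂ (refl , refl) | p , q = a , b , r , e , inj₂ (q , p)

    distinct≤ : ∀ s t → s ≤ g → t ≤ g → u s ≡ u t → s ≡ t ⊎ (s ≡ 0 × t ≡ g) ⊎ (s ≡ g × t ≡ 0)
    distinct≤ s t s≤g t≤g eq with s <? g | t <? g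
    ... | yes s<g | yes t<g = inj₁ (distinct s t s<g t<g eq)
    ... | yes s<g | no t≮g  = inj₂ (inj₁ (distinct s 0 s<g 0<g (trans eq (trans (cong u t≡g) closed)) , t≡g))
      where t≡g : t ≡ g
            t≡g = ≤-antisym t≤g (≮⇒≥ t≮g)
    ... | no s≮g  | yes t<g = inj₂ (inj₂ (s≡g , distinct t 0 t<g 0<g (trans (sym eq) (trans (cong u s≡g) closed))))
      where s≡g : s ≡ g
            s≡g = ≤-antisym s≤g (≮⇒≥ s≮g)
    ... | no s≮g  | no t≮g  = inj₁ (trans (≤-antisym s≤g (≮⇒≥ s≮g)) (sym (≤-antisym t≤g (≮⇒≥ t≮g))))

    noStutter : ∀ t → t < g → u t ≢ u (suc t)
    noStutter t t<g eq with distinct≤ t (suc t) (<⇒≤ t<g) t<g eq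
    ... | inj₁ t≡1+t               = 1+n≢n (sym t≡1+t)
    ... | inj₂ (inj₁ (refl , 1≡g)) = g≢ (s≤s (s≤s z≤n)) (sym 1≡g)
    ... | inj₂ (inj₂ (refl , _))   = <-irrefl refl t<g

    noCross : ∀ t t' → t < g → t' < g → u t ≡ u (suc t') → u (suc t) ≡ u t' → ⊥
    noCross t t' t<g t'<g e₁ e₂
      with distinct≤ t (suc t') (<⇒≤ t<g) t'<g e₁ | distinct≤ (suc t) t' t<g (<⇒≤ t'<g) e₂
    ... | inj₁ refl                | inj₁ eq                  =
      <⇒≢ (≤-trans (n<1+n t') (n≤1+n _)) (sym eq)
    ... | inj₁ refl                | inj₂ (inj₁ ())
    ... | inj₁ refl                | inj₂ (inj₂ (g≡2 , refl)) = g≢ ≤-refl (sym g≡2)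
    ... | inj₂ (inj₁ (refl , g≡2)) | inj₁ refl                = g≢ ≤-refl (sym g≡2)
    ... | inj₂ (inj₁ (refl , _))   | inj₂ (inj₁ ())
    ... | inj₂ (inj₁ (refl , g≡1)) | inj₂ (inj₂ (_ , refl))   = g≢ (s≤s (s≤s z≤n)) (sym g≡1)
    ... | inj₂ (inj₂ (refl , _))   | _                        = <-irrefl refl t<g

    fact-injective : ∀ t t' → t < g → t' < g → fact t ≡ fact t' → t ≡ t'
    fact-injective t t' t<g t'<g eq with fact-ends t t<g | fact-ends t' t'<g
    ... | a , b , r , e , ends | a' , b' , r' , e' , ends' with trans (sym e) (trans eq e')
    ... | refl with ends | ends'
    ... | inj₁ (p₁ , p₂) | inj₁ (q₁ , q₂) = distinct t t' t<g t'<g (trans (sym p₁) q₁)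
    ... | inj₂ (p₁ , p₂) | inj₂ (q₁ , q₂) = distinct t t' t<g t'<g (trans (sym p₂) q₂)
    ... | inj₁ (p₁ , p₂) | inj₂ (q₁ , q₂) = ⊥-elim (noCross t t' t<g t'<g (trans (sym p₁) q₁) (trans (sym p₂) q₂))
    ... | inj₂ (p₁ , p₂) | inj₁ (q₁ , q₂) = ⊥-elim (noCross t t' t<g t'<g (trans (sym p₂) q₂) (trans (sym p₁) q₁))

    node : ℕ → Node A
    node m = if isOdd m then inj₂ (fact (half m)) else inj₁ (u (half m))

    edgeAt : ℕ → Edge A
    edgeAt m = if isOdd m then occ₂ (half m) else occ₁ (half m)

    node-even : ∀ t → node (double t) ≡ inj₁ (u t)
    node-even t rewrite isOdd-double t | half-double t = refl

    node-odd : ∀ t → node (suc (double t)) ≡ inj₂ (fact t)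
    node-odd t rewrite isOdd-suc-double t | half-suc-double t = refl

    edge-even : ∀ t → edgeAt (double t) ≡ occ₁ t
    edge-even t rewrite isOdd-double t | half-double t = refl

    edge-odd : ∀ t → edgeAt (suc (double t)) ≡ occ₂ t
    edge-odd t rewrite isOdd-suc-double t | half-suc-double t = refl

    edgeAt-fact : ∀ m → m < double g → edgeFact A (edgeAt m) ≡ fact (half m)
    edgeAt-fact m m< with parity m
    ... | inj₁ (t , refl) rewrite edge-even t | half-double t     = proj₁ (occ₁-spec t (double-<-inv m<))
    ... | inj₂ (t , refl) rewrite edge-odd t  | half-suc-double t = proj₁ (occ₂-spec t (suc-double-<-inv m<))

    joinsAt : ∀ m → m < double g → Joins A (edgeAt m) (node m) (node (suc m))
    joinsAt m m< with parity m
    ... | inj₁ (t , refl) rewrite node-even t | node-odd t | edge-even t =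
      inj₁ (cong inj₁ (sym (proj₂ spec)) , cong inj₂ (sym (proj₁ spec)))
      where spec : edgeFact A (occ₁ t) ≡ fact t × edgeElem A (occ₁ t) ≡ u t
            spec = occ₁-spec t (double-<-inv m<)
    ... | inj₂ (t , refl) rewrite node-odd t | node-even (suc t) | edge-odd t =
      inj₂ (cong inj₂ (sym (proj₁ spec)) , cong inj₁ (sym (proj₂ spec)))
      where spec : edgeFact A (occ₂ t) ≡ fact t × edgeElem A (occ₂ t) ≡ u (suc t)
            spec = occ₂-spec t (suc-double-<-inv m<)

    node-injective : ∀ m m' → m < double g → m' < double g → node m ≡ node m' → m ≡ m'
    node-injective m m' m< m'< eq with parity m | parity m'
    ... | inj₁ (t , refl) | inj₁ (t' , refl) =
      cong double (distinct t t' (double-<-inv m<) (double-<-inv m'<)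
                    (inj₁-injective (trans (sym (node-even t)) (trans eq (node-even t')))))
    node-injective m m' m< m'< eq | inj₁ (t , refl) | inj₂ (t' , refl)
      with trans (sym (node-even t)) (trans eq (node-odd t'))
    ...   | ()
    node-injective m m' m< m'< eq | inj₂ (t , refl) | inj₁ (t' , refl)
      with trans (sym (node-odd t)) (trans eq (node-even t'))
    ...   | ()
    node-injective m m' m< m'< eq | inj₂ (t , refl) | inj₂ (t' , refl) =
      cong (suc ∘ double) (fact-injective t t' (suc-double-<-inv m<) (suc-double-<-inv m'<)
                            (inj₂-injective (trans (sym (node-odd t)) (trans eq (node-odd t')))))

    -- the two occurrences within one step differ, as its ends differ
    occ₁≢occ₂ : ∀ t t' → t < g → t ≡ t' → occ₁ t ≢ occ₂ t'
    occ₁≢occ₂ t .t t<g refl eq =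
      noStutter t t<g (trans (sym (proj₂ (occ₁-spec t t<g)))
                        (trans (cong (edgeElem A) eq) (proj₂ (occ₂-spec t t<g))))

    edge-injective : ∀ m m' → m < double g → m' < double g → edgeAt m ≡ edgeAt m' → m ≡ m'
    edge-injective m m' m< m'< eq
      with fact-injective (half m) (half m') (half-< m m<) (half-< m' m'<)
             (trans (sym (edgeAt-fact m m<)) (trans (cong (edgeFact A) eq) (edgeAt-fact m' m'<)))
    ... | same-step with parity m | parity m'
    ...   | inj₁ (t , refl) | inj₁ (t' , refl) =
      cong double (trans (sym (half-double t)) (trans same-step (half-double t')))
    ...   | inj₂ (t , refl) | inj₂ (t' , refl) =
      cong (suc ∘ double) (trans (sym (half-suc-double t)) (trans same-step (half-suc-double t')))
    ...   | inj₁ (t , refl) | inj₂ (t' , refl) =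
      ⊥-elim (occ₁≢occ₂ t t' (double-<-inv m<)
                (trans (sym (half-double t)) (trans same-step (half-suc-double t')))
                (trans (sym (edge-even t)) (trans eq (edge-odd t'))))
    ...   | inj₂ (t , refl) | inj₁ (t' , refl) =
      ⊥-elim (occ₁≢occ₂ t' t (double-<-inv m'<)
                (trans (sym (half-double t')) (trans (sym same-step) (half-suc-double t)))
                (trans (sym (edge-even t')) (trans (sym eq) (edge-odd t))))

    cycle : Cycle A
    cycle = record
      { len      = double g
      ; len≥2    = ≤-trans (s≤s (s≤s z≤n)) (double-mono 0<g)
      ; node     = λ i → node (toℕ i)
      ; edge     = λ i → edgeAt (toℕ i)
      ; joins    = λ i → subst (λ k → Joins A (edgeAt (toℕ i)) (node k) (node (suc (toℕ i))))
                                (sym (toℕ-inject₁ i)) (joinsAt (toℕ i) (toℕ<n i))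
      ; closed   = trans (cong node (toℕ-fromℕ (double g))) (trans (node-even g) (cong inj₁ closed))
      ; nodesInj = λ i j eq → toℕ-injective (node-injective (toℕ i) (toℕ j) (toℕ<n i) (toℕ<n j)
                     (subst₂ (λ k k' → node k ≡ node k') (toℕ-inject₁ i) (toℕ-inject₁ j) eq))
      ; edgesInj = λ i j eq → toℕ-injective (edge-injective (toℕ i) (toℕ j) (toℕ<n i) (toℕ<n j) eq)
      }

  -- A repetition w s = w (s + gap) with minimal gap
  -- has gap ≥ 3 and closes a walk through distinct elements: a cycle.
  module NonBacktrackingWalk (acyclic : Acyclic A) (w : ℕ → Fin (size A)) (L : ℕ)
         (adj : ∀ t → t < L → Adj (w t) (w (suc t)))
         (noStay : ∀ t → t < L → w t ≢ w (suc t))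
         (noReturn : ∀ t → 2 + t ≤ L → w t ≢ w (2 + t)) where

    noRepeat : ∀ n gap s → gap ≤ n → 1 ≤ gap → s + gap ≤ L → w s ≢ w (s + gap)
    noRepeat (suc n) 1 s _ _ s+1≤L eq =
      noStay s (subst (_≤ L) (+-comm s 1) s+1≤L) (trans eq (cong w (+-comm s 1)))
    noRepeat (suc n) 2 s _ _ s+2≤L eq =
      noReturn s (subst (_≤ L) (+-comm s 2) s+2≤L) (trans eq (cong w (+-comm s 2)))
    noRepeat (suc n) gap@(suc (suc (suc _))) s gap≤ _ s+gap≤L eq =
      acyclic (ClosedWalk.cycle u gap (s≤s (s≤s (s≤s z≤n))) adjU closedU distinctU)
      where
        u : ℕ → Fin (size A)
        u t = w (s + t)

        adjU : ∀ t → t < gap → Adj (u t) (u (suc t))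
        adjU t t< = subst (λ k → Adj (w (s + t)) (w k)) (sym (+-suc s t))
                      (adj (s + t) (≤-trans (+-monoʳ-< s t<) s+gap≤L))

        closedU : u gap ≡ u 0
        closedU = trans (sym eq) (cong w (sym (+-identityʳ s)))

        -- repetitions inside the closed walk have smaller gaps
        ordered : ∀ a b → a < b → b < gap → u a ≢ u b
        ordered a b a<b b<gap ua≡ub with <⇒+suc a<b
        ... | d , refl =
          noRepeat n (suc d) (s + a) (s≤s⁻¹ (≤-trans (s≤s (m≤n+m (suc d) a)) (≤-trans b<gap gap≤))) (s≤s z≤n)
            (subst (_≤ L) (sym (+-assoc s a (suc d))) (≤-trans (+-monoʳ-≤ s (<⇒≤ b<gap)) s+gap≤L))
            (trans ua≡ub (cong w (sym (+-assoc s a (suc d)))))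

        distinctU : ∀ a b → a < gap → b < gap → u a ≡ u b → a ≡ b
        distinctU a b a<gap b<gap ua≡ub with <-cmp a b
        ... | tri< a<b _ _ = ⊥-elim (ordered a b a<b b<gap ua≡ub)
        ... | tri≈ _ a≡b _ = a≡b
        ... | tri> _ _ b<a = ⊥-elim (ordered b a b<a a<gap (sym ua≡ub))

    injective : ∀ a b → a ≤ L → b ≤ L → w a ≡ w b → a ≡ b
    injective a b a≤L b≤L eq with <-cmp a b
    ... | tri≈ _ a≡b _ = a≡b
    ... | tri< a<b _ _ with <⇒+suc a<b
    ...   | d , refl = ⊥-elim (noRepeat L (suc d) a (≤-trans (m≤n+m (suc d) a) b≤L) (s≤s z≤n) b≤L eq)
    injective a b a≤L b≤L eq | tri> _ _ b<a with <⇒+suc b<a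
    ...   | d , refl = ⊥-elim (noRepeat L (suc d) b (≤-trans (m≤n+m (suc d) b) a≤L) (s≤s z≤n) a≤L (sym eq))

    size> : L < size A
    size> = ≰⇒> λ size≤L → case pigeonhole (s≤s size≤L) (λ (i : Fin (suc L)) → w (toℕ i)) of λ where
      (i , j , i<j , wi≡wj) → <-irrefl (injective (toℕ i) (toℕ j) (s≤s⁻¹ (toℕ<n i)) (s≤s⁻¹ (toℕ<n j)) wi≡wj) i<j

identityHom : (A : PStructure) → Hom A A
identityHom A = record { map = λ a → a ; presP = λ _ p → p ; presR = λ _ _ r → r ; presD = refl }

_∘ₕ_ : ∀ {A B C} → Hom B C → Hom A B → Hom A C
g ∘ₕ f = record
  { map   = λ a → Hom.map g (Hom.map f a)
  ; presP = λ a p → Hom.presP g _ (Hom.presP f a p)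
  ; presR = λ a b r → Hom.presR g _ _ (Hom.presR f a b r)
  ; presD = trans (cong (Hom.map g) (Hom.presD f)) (Hom.presD g)
  }

record Walk4 (A : PStructure) : Set where
  field
    v₀ v₁ v₂ v₃ v₄ : Fin (size A)
    e₀ : T (R A v₀ v₁)
    e₁ : T (R A v₁ v₂)
    e₂ : T (R A v₂ v₃)
    e₃ : T (R A v₃ v₄)

walk4⇒T' : (A : PStructure) → T (P A (dist A)) → Walk4 A → Hom T'canon A
walk4⇒T' A pd w = record { map = image ; presP = presP ; presR = presR ; presD = refl }
  where
    open Walk4 w
    image : Fin 6 → Fin (size A)
    image zero                                = dist A
    image (suc zero)                          = v₀
    image (suc (suc zero))                    = v₁
    image (suc (suc (suc zero)))              = v₂
    image (suc (suc (suc (suc zero))))        = v₃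
    image (suc (suc (suc (suc (suc zero))))) = v₄
    presP : ∀ a → T (T'P a) → T (P A (image a))
    presP zero _ = pd
    presR : ∀ a b → T (T'R a b) → T (R A (image a) (image b))
    presR (suc zero)                   (suc (suc zero))                   _ = e₀
    presR (suc (suc zero))             (suc (suc (suc zero)))             _ = e₁
    presR (suc (suc (suc zero)))       (suc (suc (suc (suc zero))))       _ = e₂
    presR (suc (suc (suc (suc zero)))) (suc (suc (suc (suc (suc zero))))) _ = e₃

-- The path variables y₁ … y₅ of T' (indices 0 … 4, larger indices stay at y₅)
-- and its path edges.
pathVariable : ℕ → Fin 6
pathVariable 0 = suc zero
pathVariable 1 = suc (suc zero)
pathVariable 2 = suc (suc (suc zero))
pathVariable 3 = suc (suc (suc (suc zero)))
pathVariable _ = suc (suc (suc (suc (suc zero))))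

pathEdge : ∀ k → k ≤ 3 → T (T'R (pathVariable k) (pathVariable (suc k)))
pathEdge 0 _ = tt
pathEdge 1 _ = tt
pathEdge 2 _ = tt
pathEdge 3 _ = tt
pathEdge (suc (suc (suc (suc _)))) (s≤s (s≤s (s≤s ())))

noLoop : ∀ {A} → ¬ Walk4 A → ∀ z → ¬ T (R A z z)
noLoop no4 z r = no4 (record { v₀ = z ; v₁ = z ; v₂ = z ; v₃ = z ; v₄ = z ; e₀ = r ; e₁ = r ; e₂ = r ; e₃ = r })

no2Cycle : ∀ {A} → ¬ Walk4 A → ∀ x y → T (R A x y) → ¬ T (R A y x)
no2Cycle no4 x y r s = no4 (record { v₀ = x ; v₁ = y ; v₂ = x ; v₃ = y ; v₄ = x ; e₀ = r ; e₁ = s ; e₂ = r ; e₃ = s })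

noT'ByHeight : ∀ {A} (h : Fin (size A) → ℕ) → (∀ a → h a ≤ 3) →
               (∀ a b → T (R A a b) → h a < h b) → ¬ Hom T'canon A
noT'ByHeight h h≤3 h-mono f = <⇒≱ (climb 3 ≤-refl) (h≤3 (map (pathVariable 4)))
  where
    open Hom f
    edge : ∀ k → k ≤ 3 → h (map (pathVariable k)) < h (map (pathVariable (suc k)))
    edge k k≤3 = h-mono _ _ (presR _ _ (pathEdge k k≤3))
    climb : ∀ k → k ≤ 3 → suc k ≤ h (map (pathVariable (suc k)))
    climb zero    _  = ≤-trans (s≤s z≤n) (edge 0 z≤n)
    climb (suc k) k≤ = ≤-trans (s≤s (climb k (≤-trans (n≤1+n k) k≤))) (edge (suc k) k≤)

-- The zigzag.  Its vertices are the natural numbers, vertex k having role k mod 8.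
data Role : Set where
  r0 r1 r2 r3 r4 r5 r6 r7 : Role

next : Role → Role
next r0 = r1
next r1 = r2
next r2 = r3
next r3 = r4
next r4 = r5
next r5 = r6
next r6 = r7
next r7 = r0

role : ℕ → Role
role zero    = r0
role (suc k) = next (role k)

role-periodic : ∀ k → role (8 + k) ≡ role k
role-periodic k with role k
... | r0 = refl
... | r1 = refl
... | r2 = refl
... | r3 = refl
... | r4 = refl
... | r5 = refl
... | r6 = refl
... | r7 = refl

ascending descending isR1 isR5 : Role → Bool
ascending r0 = true
ascending r1 = true
ascending r2 = true
ascending _  = false
descending r4 = true
descending r5 = true
descending r6 = true
descending _  = false
isR1 r1 = true
isR1 _  = false
isR5 r5 = true
isR5 _  = false

-- Per period (8 ≡ 0 of the next period):
--   0 → 1 → 2 → 3,   1 → 4,   7 → 6 → 5 → 4,   8 → 5,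
-- i.e. the spine 0, 1, 4, 5, 8, … with the pendant paths 1 → 2 → 3 and
-- 7 → 6 → 5 attached.
data Ed : ℕ → ℕ → Set where
  up  : ∀ {i} → T (ascending (role i)) → Ed i (suc i)
  jup : ∀ {i} → T (isR1 (role i)) → Ed i (3 + i)
  dn  : ∀ {j} → T (descending (role j)) → Ed (suc j) j
  jdn : ∀ {j} → T (isR5 (role j)) → Ed (3 + j) j

-- Edges are decidable, so they can serve as the Bool-valued relation of Q.
Ed? : ∀ i j → Dec (Ed i j)
Ed? i j = map′ fromCode toCode
  (   (j ≟ suc i ×-dec T? (ascending (role i)))
  ⊎-dec (j ≟ 3 + i ×-dec T? (isR1 (role i)))
  ⊎-dec (i ≟ suc j ×-dec T? (descending (role j)))
  ⊎-dec (i ≟ 3 + j ×-dec T? (isR5 (role j))))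
  where
    fromCode : _ → Ed i j
    fromCode (inj₁ (refl , q))                 = up q
    fromCode (inj₂ (inj₁ (refl , q)))          = jup q
    fromCode (inj₂ (inj₂ (inj₁ (refl , q))))   = dn q
    fromCode (inj₂ (inj₂ (inj₂ (refl , q))))   = jdn q
    toCode : Ed i j → _
    toCode (up q)  = inj₁ (refl , q)
    toCode (jup q) = inj₂ (inj₁ (refl , q))
    toCode (dn q)  = inj₂ (inj₂ (inj₁ (refl , q)))
    toCode (jdn q) = inj₂ (inj₂ (inj₂ (refl , q)))

Ed-shift : ∀ {i j} → Ed i j → Ed (8 + i) (8 + j)
Ed-shift {i} (up q)      = up  (subst (T ∘ ascending)  (sym (role-periodic i)) q)
Ed-shift {i} (jup q)     = jup (subst (T ∘ isR1)       (sym (role-periodic i)) q)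
Ed-shift {_} {j} (dn q)  = dn  (subst (T ∘ descending) (sym (role-periodic j)) q)
Ed-shift {_} {j} (jdn q) = jdn (subst (T ∘ isR5)       (sym (role-periodic j)) q)

-- Levels 0 … 4: every edge climbs exactly one level, so the zigzag maps onto
-- the directed path y₁ → … → y₅ of T'.
levelOf : Role → ℕ
levelOf r0 = 1
levelOf r1 = 2
levelOf r2 = 3
levelOf r3 = 4
levelOf r4 = 3
levelOf r5 = 2
levelOf r6 = 1
levelOf r7 = 0

level : ℕ → ℕ
level k = levelOf (role k)

level≤4 : ∀ k → level k ≤ 4
level≤4 k with role k
... | r0 = s≤s z≤n
... | r1 = s≤s (s≤s z≤n)
... | r2 = s≤s (s≤s (s≤s z≤n))
... | r3 = ≤-refl
... | r4 = s≤s (s≤s (s≤s z≤n))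
... | r5 = s≤s (s≤s z≤n)
... | r6 = s≤s z≤n
... | r7 = z≤n

Ed-level : ∀ {i j} → Ed i j → level j ≡ suc (level i)
Ed-level {i} (up q) = go (role i) q
  where go : ∀ r → T (ascending r) → levelOf (next r) ≡ suc (levelOf r)
        go r0 _ = refl
        go r1 _ = refl
        go r2 _ = refl
Ed-level {i} (jup q) = go (role i) q
  where go : ∀ r → T (isR1 r) → levelOf (next (next (next r))) ≡ suc (levelOf r)
        go r1 _ = refl
Ed-level {_} {j} (dn q) = go (role j) q
  where go : ∀ r → T (descending r) → levelOf r ≡ suc (levelOf (next r))
        go r4 _ = refl
        go r5 _ = refl
        go r6 _ = refl
Ed-level {_} {j} (jdn q) = go (role j) q
  where go : ∀ r → T (isR5 r) → levelOf r ≡ suc (levelOf (next (next (next r))))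
        go r5 _ = refl

Ed-irreflexive : ∀ {i} → ¬ Ed i i
Ed-irreflexive e = 1+n≢n (sym (Ed-level e))

-- Heights 0 … 3 strictly increase along edges: the zigzag has no directed
-- path with four edges.
heightOf : Role → ℕ
heightOf r0 = 0
heightOf r1 = 1
heightOf r2 = 2
heightOf r3 = 3
heightOf r4 = 3
heightOf r5 = 2
heightOf r6 = 1
heightOf r7 = 0

height : ℕ → ℕ
height k = heightOf (role k)

height≤3 : ∀ k → height k ≤ 3
height≤3 k with role k
... | r0 = z≤n
... | r1 = s≤s z≤n
... | r2 = s≤s (s≤s z≤n)
... | r3 = ≤-refl
... | r4 = ≤-refl
... | r5 = s≤s (s≤s z≤n)
... | r6 = s≤s z≤n
... | r7 = z≤n

Ed-height : ∀ {i j} → Ed i j → height i < height j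
Ed-height {i} (up q) = go (role i) q
  where go : ∀ r → T (ascending r) → heightOf r < heightOf (next r)
        go r0 _ = s≤s z≤n
        go r1 _ = s≤s (s≤s z≤n)
        go r2 _ = s≤s (s≤s (s≤s z≤n))
Ed-height {i} (jup q) = go (role i) q
  where go : ∀ r → T (isR1 r) → heightOf r < heightOf (next (next (next r)))
        go r1 _ = s≤s (s≤s z≤n)
Ed-height {_} {j} (dn q) = go (role j) q
  where go : ∀ r → T (descending r) → heightOf (next r) < heightOf r
        go r4 _ = s≤s (s≤s (s≤s z≤n))
        go r5 _ = s≤s (s≤s z≤n)
        go r6 _ = s≤s z≤n
Ed-height {_} {j} (jdn q) = go (role j) q
  where go : ∀ r → T (isR5 r) → heightOf (next (next (next r))) < heightOf r
        go r5 _ = s≤s z≤n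

-- The zigzag is a tree rooted at 0: each vertex v ≥ 1 has exactly one edge to
-- a smaller vertex, namely lowerEdge v (as a pair source, target).
lowerEdgeOf : Role → ℕ → ℕ × ℕ
lowerEdgeOf r0 v = v , v ∸ 3
lowerEdgeOf r1 v = pred v , v
lowerEdgeOf r2 v = pred v , v
lowerEdgeOf r3 v = pred v , v
lowerEdgeOf r4 v = v ∸ 3 , v
lowerEdgeOf r5 v = v , pred v
lowerEdgeOf r6 v = v , pred v
lowerEdgeOf r7 v = v , pred v

lowerEdge : ℕ → ℕ × ℕ
lowerEdge v = lowerEdgeOf (role v) v

EdgeBelow : ℕ → ℕ → ℕ → Set
EdgeBelow v a b = (a ≡ v × b < v) ⊎ (b ≡ v × a < v)

lowerEdge-unique : ∀ {v a b} → Ed a b → EdgeBelow v a b → (a , b) ≡ lowerEdge v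
lowerEdge-unique {_} {i} (up q) (inj₁ (refl , i+1<i)) = ⊥-elim (<-asym i+1<i (n<1+n i))
lowerEdge-unique {_} {i} (up q) (inj₂ (refl , _))     = go (role i) q
  where go : ∀ r → T (ascending r) → (i , suc i) ≡ lowerEdgeOf (next r) (suc i)
        go r0 _ = refl
        go r1 _ = refl
        go r2 _ = refl
lowerEdge-unique {_} {i} (jup q) (inj₁ (refl , i+3<i)) = ⊥-elim (<-asym i+3<i (m<n+m i (s≤s z≤n)))
lowerEdge-unique {_} {i} (jup q) (inj₂ (refl , _))     = go (role i) q
  where go : ∀ r → T (isR1 r) → (i , 3 + i) ≡ lowerEdgeOf (next (next (next r))) (3 + i)
        go r1 _ = refl
lowerEdge-unique {_} {_} {j} (dn q) (inj₁ (refl , _))     = go (role j) q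
  where go : ∀ r → T (descending r) → (suc j , j) ≡ lowerEdgeOf (next r) (suc j)
        go r4 _ = refl
        go r5 _ = refl
        go r6 _ = refl
lowerEdge-unique {_} {_} {j} (dn q) (inj₂ (refl , j+1<j)) = ⊥-elim (<-asym j+1<j (n<1+n j))
lowerEdge-unique {_} {_} {j} (jdn q) (inj₁ (refl , _))     = go (role j) q
  where go : ∀ r → T (isR5 r) → (3 + j , j) ≡ lowerEdgeOf (next (next (next r))) (3 + j)
        go r5 _ = refl
lowerEdge-unique {_} {_} {j} (jdn q) (inj₂ (refl , j+3<j)) = ⊥-elim (<-asym j+3<j (m<n+m j (s≤s z≤n)))

twoBefore-r3 : ∀ k → role k ≡ r3 → Σ ℕ λ z → k ≡ 2 + z × T (isR1 (role z))
twoBefore-r3 (suc (suc z)) eq = z , refl , go (role z) eq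
  where go : ∀ r → next (next r) ≡ r3 → T (isR1 r)
        go r1 _ = tt

twoBefore-r7 : ∀ k → role k ≡ r7 → Σ ℕ λ z → k ≡ 2 + z × T (isR5 (role z))
twoBefore-r7 (suc (suc z)) eq = z , refl , go (role z) eq
  where go : ∀ r → next (next r) ≡ r7 → T (isR5 r)
        go r5 _ = tt

lowerNeighbour : ∀ k → Σ ℕ λ p → p < suc k × (Ed p (suc k) ⊎ Ed (suc k) p)
lowerNeighbour k with role k in eq
... | r0 = k , ≤-refl , inj₁ (up (subst (T ∘ ascending) (sym eq) tt))
... | r1 = k , ≤-refl , inj₁ (up (subst (T ∘ ascending) (sym eq) tt))
... | r2 = k , ≤-refl , inj₁ (up (subst (T ∘ ascending) (sym eq) tt))
... | r4 = k , ≤-refl , inj₂ (dn (subst (T ∘ descending) (sym eq) tt))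
... | r5 = k , ≤-refl , inj₂ (dn (subst (T ∘ descending) (sym eq) tt))
... | r6 = k , ≤-refl , inj₂ (dn (subst (T ∘ descending) (sym eq) tt))
... | r3 with twoBefore-r3 k eq
...   | z , refl , z∈r1 = z , s≤s (m≤n+m z 2) , inj₁ (jup z∈r1)
lowerNeighbour k | r7 with twoBefore-r7 k eq
...   | z , refl , z∈r5 = z , s≤s (m≤n+m z 2) , inj₂ (jdn z∈r5)

spine : ℕ → ℕ
spine 0 = 0
spine 1 = 1
spine 2 = 4
spine 3 = 5
spine (suc (suc (suc (suc t)))) = 8 + spine t

spine≤ : ∀ t → spine t ≤ double t
spine≤ 0 = z≤n
spine≤ 1 = s≤s z≤n
spine≤ 2 = ≤-refl
spine≤ 3 = s≤s (s≤s (s≤s (s≤s (s≤s z≤n))))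
spine≤ (suc (suc (suc (suc t)))) = +-monoʳ-≤ 8 (spine≤ t)

spine-adjacent : ∀ t → Ed (spine t) (spine (suc t)) ⊎ Ed (spine (suc t)) (spine t)
spine-adjacent 0 = inj₁ (up tt)
spine-adjacent 1 = inj₁ (jup tt)
spine-adjacent 2 = inj₂ (dn tt)
spine-adjacent 3 = inj₂ (jdn tt)
spine-adjacent (suc (suc (suc (suc t)))) with spine-adjacent t
... | inj₁ e = inj₁ (Ed-shift e)
... | inj₂ e = inj₂ (Ed-shift e)

Into2 Out2 : ℕ → Set
Into2 v = Σ ℕ λ x → Σ ℕ λ y → Ed x y × Ed y v
Out2  v = Σ ℕ λ x → Σ ℕ λ y → Ed v x × Ed x y

-- Reasons why identifying a and c in a path a – b – c creates a directed
-- walk with four edges: a 2-cycle through b, or a 2-path into a followed by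
-- a 2-path out of c (or vice versa).
data Merge (a b c : ℕ) : Set where
  forward  : Ed a b → Ed b c → Merge a b c
  backward : Ed c b → Ed b a → Merge a b c
  inOut    : Into2 a → Out2 c → Merge a b c
  outIn    : Out2 a → Into2 c → Merge a b c

shift-Into2 : ∀ {v} → Into2 v → Into2 (8 + v)
shift-Into2 (x , y , e , e') = 8 + x , 8 + y , Ed-shift e , Ed-shift e'

shift-Out2 : ∀ {v} → Out2 v → Out2 (8 + v)
shift-Out2 (x , y , e , e') = 8 + x , 8 + y , Ed-shift e , Ed-shift e'

spine-merge : ∀ t → Merge (spine t) (spine (1 + t)) (spine (2 + t))
spine-merge 0 = forward (up tt) (jup tt)
spine-merge 1 = outIn (2 , 3 , up tt , up tt) (7 , 6 , dn tt , dn tt)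
spine-merge 2 = backward (jdn tt) (dn tt)
spine-merge 3 = inOut (7 , 6 , dn tt , dn tt) (10 , 11 , up tt , up tt)
spine-merge (suc (suc (suc (suc t)))) with spine-merge t
... | forward e e'  = forward (Ed-shift e) (Ed-shift e')
... | backward e e' = backward (Ed-shift e) (Ed-shift e')
... | inOut i o     = inOut (shift-Into2 i) (shift-Out2 o)
... | outIn o i     = outIn (shift-Out2 o) (shift-Into2 i)

Ed-near : ∀ {i j} → Ed i j → j ≤ 3 + i × i ≤ 3 + j
Ed-near {i} (up _)      = m≤n+m (suc i) 2 , ≤-trans (n≤1+n i) (m≤n+m (suc i) 3)
Ed-near {i} (jup _)     = ≤-refl , ≤-trans (m≤n+m i 3) (m≤n+m (3 + i) 3)
Ed-near {_} {j} (dn _)  = ≤-trans (n≤1+n j) (m≤n+m (suc j) 3) , m≤n+m (suc j) 2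
Ed-near {_} {j} (jdn _) = ≤-trans (m≤n+m j 3) (m≤n+m (3 + j) 3) , ≤-refl

-- The structure Q M: the answer variable x (element zero, the only P-fact)
-- and the zigzag vertices 0 … M-1, vertex k being the element suc k.
QP : ∀ {M} → Fin (suc M) → Bool
QP zero    = true
QP (suc _) = false

QR : ∀ {M} → Fin (suc M) → Fin (suc M) → Bool
QR (suc a) (suc b) = isYes (Ed? (toℕ a) (toℕ b))
QR _       _       = false

Q : ℕ → PStructure
Q M = record { size = suc M ; P = QP ; R = QR ; dist = zero }

-- the element of vertex k (x when k is out of range, which never matters)
vertex : ∀ {M} → ℕ → Fin (suc M)
vertex {M} k with k <? M
... | yes k<M = suc (fromℕ< k<M)
... | no _    = zero

vertex-< : ∀ {M} k (k<M : k < M) → vertex {M} k ≡ suc (fromℕ< k<M)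
vertex-< {M} k k<M with k <? M
... | yes _   = refl
... | no k≮M   = ⊥-elim (k≮M k<M)

vertex-toℕ : ∀ {M} (a : Fin M) → vertex {M} (toℕ a) ≡ suc a
vertex-toℕ a = trans (vertex-< (toℕ a) (toℕ<n a)) (cong suc (fromℕ<-toℕ a (toℕ<n a)))

Q-edge : ∀ {M i j} → Ed i j → i < M → j < M → T (QR (vertex {M} i) (vertex {M} j))
Q-edge {M} {i} {j} e i<M j<M
  rewrite vertex-< i i<M | vertex-< j j<M | toℕ-fromℕ< i<M | toℕ-fromℕ< j<M = fromWitness e

-- Q M is acyclic by the ranking criterion (elements ranked by vertex number).
Q-irreflexive : ∀ M → Irreflexive (Q M)
Q-irreflexive M (suc a) r = Ed-irreflexive (toWitness r)

-- the facts below vertex v are zigzag edges below v, and there is only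
-- lowerEdge v
Q-uniqueFactsBelow : ∀ M → UniqueFactsBelow (Q M)
Q-uniqueFactsBelow M zero (suc a) (suc b) _ _ _ _ (inj₁ (() , _)) _
Q-uniqueFactsBelow M zero (suc a) (suc b) _ _ _ _ (inj₂ (() , _)) _
Q-uniqueFactsBelow M (suc v) (suc a) (suc b) (suc a') (suc b') r r' below below' =
  cong suc (toℕ-injective (proj₁ (,-injective same))) , cong suc (toℕ-injective (proj₂ (,-injective same)))
  where
    asEdge : ∀ {x y} → FactBelow (Q M) (suc v) (suc x) (suc y) → EdgeBelow (toℕ v) (toℕ x) (toℕ y)
    asEdge (inj₁ (eq , lt)) = inj₁ (cong toℕ (Fin-suc-injective eq) , s≤s⁻¹ lt)
    asEdge (inj₂ (eq , lt)) = inj₂ (cong toℕ (Fin-suc-injective eq) , s≤s⁻¹ lt)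
    same : (toℕ a , toℕ b) ≡ (toℕ a' , toℕ b')
    same = trans (lowerEdge-unique (toWitness r) (asEdge below))
                 (sym (lowerEdge-unique (toWitness r') (asEdge below')))

Q-acyclic : ∀ M → Acyclic (Q M)
Q-acyclic M = acyclicByRank (Q M) (Q-irreflexive M) (Q-uniqueFactsBelow M)

occursByEdge : ∀ {M} (a : Fin M) {k} → k ≡ toℕ a → ∀ j → j < M → Ed k j ⊎ Ed j k → Occurs (Q M) (suc a)
occursByEdge a refl j j<M (inj₁ e) =
  inj₂ (vertex j , inj₁ (subst (λ z → T (QR z (vertex j))) (vertex-toℕ a) (Q-edge e (toℕ<n a) j<M)))
occursByEdge a refl j j<M (inj₂ e) =
  inj₂ (vertex j , inj₂ (subst (λ z → T (QR (vertex j) z)) (vertex-toℕ a) (Q-edge e j<M (toℕ<n a))))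

-- Every element of Q M occurs in an atom: x in P(x), vertex 0 in the edge
-- 0 → 1 (this needs M ≥ 2), and every other vertex in an edge to a lower one.
Q-occurs : ∀ M → 2 ≤ M → ∀ v → Occurs (Q M) v
Q-occurs M _   zero    = inj₁ tt
Q-occurs M 2≤M (suc a) = atVertex (toℕ a) refl
  where
    atVertex : ∀ k → k ≡ toℕ a → Occurs (Q M) (suc a)
    atVertex zero    k≡a = occursByEdge a k≡a 1 2≤M (inj₁ (up tt))
    atVertex (suc k) k≡a with lowerNeighbour k
    ... | p , p<k , e = occursByEdge a k≡a p (<-trans p<k (subst (_< M) (sym k≡a) (toℕ<n a))) (swap e)

-- Q M ⇒ T': x ↦ x and each vertex to the path variable of its level.
Q⇒T' : ∀ M → Hom (Q M) T'canon
Q⇒T' M = record { map = image ; presP = presP ; presR = presR ; presD = refl }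
  where
    image : Fin (suc M) → Fin 6
    image zero    = zero
    image (suc a) = pathVariable (level (toℕ a))
    presP : ∀ a → T (QP a) → T (T'P (image a))
    presP zero _ = tt
    presR : ∀ a b → T (QR a b) → T (T'R (image a) (image b))
    presR (suc a) (suc b) r =
      subst (λ k → T (T'R (pathVariable (level (toℕ a))) (pathVariable k))) (sym climbs)
            (pathEdge _ (s≤s⁻¹ (subst (_≤ 4) climbs (level≤4 (toℕ b)))))
      where climbs : level (toℕ b) ≡ suc (level (toℕ a))
            climbs = Ed-level (toWitness r)

-- T' has no answer on Q M: it has no directed path with four edges.
T'⇏Q : ∀ M → ¬ Hom T'canon (Q M)
T'⇏Q M = noT'ByHeight h h≤3 h-mono
  where
    h : Fin (suc M) → ℕ
    h zero    = 0
    h (suc a) = height (toℕ a)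
    h≤3 : ∀ a → h a ≤ 3
    h≤3 zero    = z≤n
    h≤3 (suc a) = height≤3 (toℕ a)
    h-mono : ∀ a b → T (QR a b) → h a < h b
    h-mono (suc a) (suc b) r = Ed-height (toWitness r)

module ZigzagImage (e : PStructure) (M : ℕ) (g : ℕ → Fin (size e))
       (pres : ∀ {i j} → Ed i j → i < M → j < M → T (R e (g i) (g j)))
       (no4 : ¬ Walk4 e) where

  Into2-< : ∀ {v x y} → Ed x y → Ed y v → 6 + v < M → x < M × y < M
  Into2-< {v} e₁ e₂ v< =
    ≤-<-trans (≤-trans (proj₂ (Ed-near e₁)) (+-monoʳ-≤ 3 (proj₂ (Ed-near e₂)))) v< ,
    ≤-<-trans (≤-trans (proj₂ (Ed-near e₂)) (+-monoˡ-≤ v (s≤s (s≤s (s≤s z≤n))))) v<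

  Out2-< : ∀ {v x y} → Ed v x → Ed x y → 6 + v < M → x < M × y < M
  Out2-< {v} e₁ e₂ v< =
    ≤-<-trans (≤-trans (proj₁ (Ed-near e₁)) (+-monoˡ-≤ v (s≤s (s≤s (s≤s z≤n))))) v< ,
    ≤-<-trans (≤-trans (proj₁ (Ed-near e₂)) (+-monoʳ-≤ 3 (proj₁ (Ed-near e₁)))) v<

  in-range : ∀ {v} → 6 + v < M → v < M
  in-range {v} = ≤-<-trans (m≤n+m v 6)

  merge-impossible : ∀ {a b c} → Merge a b c → 6 + a < M → 6 + b < M → 6 + c < M → g a ≢ g c
  merge-impossible {a} {b} {c} (forward ab bc) a< b< c< ga≡gc =
    no2Cycle no4 (g a) (g b) (pres ab (in-range a<) (in-range b<))
      (subst (λ z → T (R e (g b) z)) (sym ga≡gc) (pres bc (in-range b<) (in-range c<)))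
  merge-impossible {a} {b} {c} (backward cb ba) a< b< c< ga≡gc =
    no2Cycle no4 (g b) (g a) (pres ba (in-range b<) (in-range a<))
      (subst (λ z → T (R e z (g b))) (sym ga≡gc) (pres cb (in-range c<) (in-range b<)))
  merge-impossible {a} {c = c} (inOut (x , y , xy , ya) (x' , y' , cx' , x'y')) a< _ c< ga≡gc =
    no4 (record { e₀ = pres xy (proj₁ into) (proj₂ into)
                ; e₁ = pres ya (proj₂ into) (in-range a<)
                ; e₂ = subst (λ z → T (R e z (g x'))) (sym ga≡gc) (pres cx' (in-range c<) (proj₁ out))
                ; e₃ = pres x'y' (proj₁ out) (proj₂ out) })
    where into : x < M × y < M
          into = Into2-< xy ya a<
          out : x' < M × y' < M
          out = Out2-< cx' x'y' c<
  merge-impossible {a} {c = c} (outIn (x , y , ax , xy) (x' , y' , x'y' , y'c)) a< _ c< ga≡gc =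
    no4 (record { e₀ = pres x'y' (proj₁ into) (proj₂ into)
                ; e₁ = pres y'c (proj₂ into) (in-range c<)
                ; e₂ = subst (λ z → T (R e z (g x))) ga≡gc (pres ax (in-range a<) (proj₁ out))
                ; e₃ = pres xy (proj₁ out) (proj₂ out) })
    where into : x' < M × y' < M
          into = Into2-< x'y' y'c c<
          out : x < M × y < M
          out = Out2-< ax xy a<

-- If Q M with M = 2L + 7 maps to an acyclic structure e in which T' fails at
-- the distinguished element, then e has more than L elements: the images of
-- the spine vertices 0 … L form a walk that neither stays (no loops) nor
-- returns after two steps (merge-impossible), hence visits L + 1 elements.
Q-image-large : ∀ e L → Acyclic e → Negative T' e → Hom (Q (7 + double L)) e → L < size e
Q-image-large e L acyclic negT f =
  NonBacktrackingWalk.size> e acyclic w L adjacent noStay noReturn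
  where
    M : ℕ
    M = 7 + double L
    open Hom f

    no4 : ¬ Walk4 e
    no4 walk = negT (walk4⇒T' e (subst (T ∘ P e) presD (presP zero tt)) walk)

    g : ℕ → Fin (size e)
    g k = map (vertex k)

    pres : ∀ {i j} → Ed i j → i < M → j < M → T (R e (g i) (g j))
    pres ed i< j< = presR _ _ (Q-edge ed i< j<)

    open ZigzagImage e M g pres no4

    w : ℕ → Fin (size e)
    w t = g (spine t)

    spine-in-range : ∀ t → t ≤ L → 6 + spine t < M
    spine-in-range t t≤L = s≤s (+-monoʳ-≤ 6 (≤-trans (spine≤ t) (double-mono t≤L)))

    adjacent : ∀ t → t < L → Adj e (w t) (w (suc t))
    adjacent t t<L = ⊎-map (λ ed → pres ed here there) (λ ed → pres ed there here) (spine-adjacent t)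
      where here : spine t < M
            here = in-range (spine-in-range t (<⇒≤ t<L))
            there : spine (suc t) < M
            there = in-range (spine-in-range (suc t) t<L)

    noStay : ∀ t → t < L → w t ≢ w (suc t)
    noStay t t<L eq with adjacent t t<L
    ... | inj₁ r = noLoop no4 (w t) (subst (λ z → T (R e (w t) z)) (sym eq) r)
    ... | inj₂ r = noLoop no4 (w t) (subst (λ z → T (R e z (w t))) (sym eq) r)

    noReturn : ∀ t → 2 + t ≤ L → w t ≢ w (2 + t)
    noReturn t t+2≤L = merge-impossible (spine-merge t)
      (spine-in-range t (≤-trans (m≤n+m t 2) t+2≤L))
      (spine-in-range (suc t) (≤-trans (n≤1+n (suc t)) t+2≤L))
      (spine-in-range (2 + t) t+2≤L)

totalSize : List PStructure → ℕ
totalSize []       = 0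
totalSize (e ∷ es) = size e + totalSize es

size≤totalSize : ∀ es → All (λ e → size e ≤ totalSize es) es
size≤totalSize []       = []
size≤totalSize (e ∷ es) =
  m≤m+n (size e) (totalSize es) ∷ All-map (λ le → ≤-trans le (m≤n+m _ (size e))) (size≤totalSize es)

-- the unary CQ q_L with canonical structure Q (2L + 7); M ≥ 2 makes every
-- variable occur
q : ℕ → UCQ
q L = record { canon = Q (7 + double L) ; occurs = Q-occurs (7 + double L) (s≤s (s≤s z≤n)) }

q-negative : ∀ L e → Acyclic e → Negative T' e → size e ≤ L → Negative (q L) e
q-negative L e acyclic negT small f = <⇒≱ (Q-image-large e L acyclic negT f) small

-- Theorem 4.8.  Let L be the total size of the negative examples.  Then q_L
-- is acyclic, positive on E⁺ (it maps to T'), negative on E⁻, yet not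
-- equivalent to T' (T' has no answer on q_L itself, while q_L does).
theorem4p8 : ¬ (Σ (List PStructure) λ E⁺ → Σ (List PStructure) λ E⁻ →
                 All Acyclic E⁺ × All Acyclic E⁻ × UniquelyCharacterizesAcyc E⁺ E⁻ T')
theorem4p8 (E⁺ , E⁻ , _ , acyclic⁻ , positive , negative , characterizes) =
  T'⇏Q M (proj₂ (equivalent (Q M) zero) (identityHom (Q M)))
  where
    L M : ℕ
    L = totalSize E⁻
    M = 7 + double L
    positive-q : All (Positive (q L)) E⁺
    positive-q = All-map (_∘ₕ Q⇒T' M) positive
    negative-q : All (Negative (q L)) E⁻
    negative-q = All-zipWith (λ ((acyclic , negT) , small) → q-negative L _ acyclic negT small)
                   (All-zip (acyclic⁻ , negative) , size≤totalSize E⁻)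
    equivalent : Equivalent T' (q L)
    equivalent = characterizes (q L) (Q-acyclic M) positive-q negative-q
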